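{- Let $a,b,c$ be positive integers with $a<b$ and $a!\,b! = c!$, and put $k := c-b$. Then $$k < a < k + 2\lceil \log_2 c\rceil .$$
   Context: A solution of $a!\,b!=c!$ in integers with $a<b$ is called a class $k$ solution if $c-b=k$; the claim concerns a class $k$ solution. -}

module Defs where

{-# OPTIONS --safe #-}
module Submission where

-- Writing c = b + k, the equation says a! = (b + 1)(b + 2) ⋯ (b + k), which exceeds k! ≥ a!
-- when a ≤ k; hence k < a. For the upper bound compare powers of 2: by Legendre's formula
-- v₂(n!) = n − s₂(n), with s₂ the binary digit sum, the equation becomes
-- a + s₂(c) = k + s₂(a) + s₂(b). As c ≤ 2^L for L = ⌈log₂ c⌉, the numbers a and b (if b < c)
-- have at most L binary digits, and s₂(c) ≥ 1, so a < k + 2L.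

open import Defs
open import Data.Nat using (ℕ; _+_; _*_; _∸_; _<_; _!)
open import Data.Nat.Logarithm using (⌈log₂_⌉)
open import Data.Product using (_×_)
open import Relation.Binary.PropositionalEquality using (_≡_)

open import Data.Digit using (Bit; Expansion; fromDigits; toDigits)
open import Data.Fin using (zero; suc; toℕ)
open import Data.Fin.Properties using (toℕ≤pred[n])
open import Data.List using ([]; _∷_; map)
open import Data.Nat using (zero; suc; _≤_; _^_; z≤n; s≤s; z<s; ⌊_/2⌋; ⌈_/2⌉)
open import Data.Nat.DivMod using (_%_; _divMod_; result; [m+kn]%n≡m%n; m*n%n≡0)
open import Data.Nat.ListAction using (sum)
open import Data.Nat.Induction using (Acc; acc; <-wellFounded)
open import Data.Nat.Logarithm.Core using (⌈log2⌉)
open import Data.Nat.Properties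
open import Algebra.Properties.CommutativeSemigroup *-commutativeSemigroup
  using (x∙yz≈y∙xz)
open import Data.Nat.Solver using (module +-*-Solver)
open import Data.Product using (∃-syntax; _,_)
open import Relation.Binary.PropositionalEquality
  using (_≢_; refl; sym; trans; cong; cong₂; subst; module ≡-Reasoning)
open import Relation.Nullary using (contradiction)

open +-*-Solver

!-mono-≤ : ∀ {m n} → m ≤ n → m ! ≤ n !
!-mono-≤ {n = n} z≤n = 1≤n! n
!-mono-≤ (s≤s m≤n)   = *-mono-≤ (s≤s m≤n) (!-mono-≤ m≤n)

!-mono-< : ∀ {m n} → 0 < m → m < n → m ! < n !
!-mono-< {m} 0<m m<n = <-≤-trans m!<[1+m]! (!-mono-≤ m<n)
  where
  m!<[1+m]! : m ! < suc m !
  m!<[1+m]! = m<m+n (m !) (*-mono-≤ 0<m (1≤n! m))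

!-cancel-≤ : ∀ {m n} → 0 < n → m ! ≤ n ! → m ≤ n
!-cancel-≤ 0<n m!≤n! = ≮⇒≥ λ n<m → <⇒≱ (!-mono-< 0<n n<m) m!≤n!

-- Shifted by one from the usual rising factorial: rising b k = (b + 1)(b + 2) ⋯ (b + k).
rising : ℕ → ℕ → ℕ
rising b zero    = 1
rising b (suc k) = suc (b + k) * rising b k

[b+k]!≡b!*rising : ∀ b k → (b + k) ! ≡ b ! * rising b k
[b+k]!≡b!*rising b zero    = trans (cong _! (+-identityʳ b)) (sym (*-identityʳ (b !)))
[b+k]!≡b!*rising b (suc k) = begin
  (b + suc k) !                      ≡⟨ cong _! (+-suc b k) ⟩
  suc (b + k) * (b + k) !            ≡⟨ cong (suc (b + k) *_) ([b+k]!≡b!*rising b k) ⟩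
  suc (b + k) * (b ! * rising b k)   ≡⟨ x∙yz≈y∙xz (suc (b + k)) (b !) (rising b k) ⟩
  b ! * (suc (b + k) * rising b k)   ∎
  where open ≡-Reasoning

!≤rising : ∀ b k → k ! ≤ rising b k
!≤rising b zero    = ≤-refl
!≤rising b (suc k) = *-mono-≤ (s≤s (m≤n+m k b)) (!≤rising b k)

!<rising : ∀ {b k} → 0 < b → 0 < k → k ! < rising b k
!<rising {suc b} {suc k} _ _ = begin-strict
  suc k * k !                        <⟨ *-monoˡ-< (k !) {{k !≢0}} (s≤s (s≤s (m≤n+m k b))) ⟩
  suc (suc b + k) * k !              ≤⟨ *-monoʳ-≤ (suc (suc b + k)) (!≤rising (suc b) k) ⟩
  suc (suc b + k) * rising (suc b) k ∎
  where open ≤-Reasoning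

infix 4 2^_∥_

record 2^_∥_ (e n : ℕ) : Set where
  constructor exactly
  field
    u         : ℕ
    n≡2^e*odd : n ≡ 2 ^ e * (1 + u * 2)

odd≢even : ∀ u v → 1 + u * 2 ≢ v * 2
odd≢even u v eq = 1+n≢0 (begin
  1                ≡⟨ [m+kn]%n≡m%n 1 u 2 ⟨
  (1 + u * 2) % 2  ≡⟨ cong (_% 2) eq ⟩
  (v * 2) % 2      ≡⟨ m*n%n≡0 v 2 ⟩
  0                ∎)
  where open ≡-Reasoning

2^∥-unique : ∀ {n e f} → 2^ e ∥ n → 2^ f ∥ n → e ≡ f
2^∥-unique {e = e} {f} (exactly u refl) (exactly w eq) = exponents-equal e f eq
  where
  2*x*y≡x*y*2 : ∀ x y → 2 * x * y ≡ x * y * 2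
  2*x*y≡x*y*2 x y = trans (*-assoc 2 x y) (*-comm 2 (x * y))

  exponents-equal : ∀ e f → 2 ^ e * (1 + u * 2) ≡ 2 ^ f * (1 + w * 2) → e ≡ f
  exponents-equal zero    zero    _  = refl
  exponents-equal zero    (suc f) eq =
    contradiction (trans (sym (*-identityˡ _)) (trans eq (2*x*y≡x*y*2 (2 ^ f) (1 + w * 2))))
                  (odd≢even u (2 ^ f * (1 + w * 2)))
  exponents-equal (suc e) zero    eq =
    contradiction (trans (sym (*-identityˡ _)) (trans (sym eq) (2*x*y≡x*y*2 (2 ^ e) (1 + u * 2))))
                  (odd≢even w (2 ^ e * (1 + u * 2)))
  exponents-equal (suc e) (suc f) eq = cong suc (exponents-equal e f
    (*-cancelˡ-≡ _ _ 2 (trans (sym (*-assoc 2 (2 ^ e) _)) (trans eq (*-assoc 2 (2 ^ f) _)))))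

2^∥-* : ∀ {m n e f} → 2^ e ∥ m → 2^ f ∥ n → 2^ e + f ∥ m * n
2^∥-* {e = e} {f} (exactly u refl) (exactly w refl) = exactly (u + w + u * w * 2) (begin
  2 ^ e * (1 + u * 2) * (2 ^ f * (1 + w * 2))
    ≡⟨ solve 4 (λ p q u w → p :* (con 1 :+ u :* con 2) :* (q :* (con 1 :+ w :* con 2))
                         := p :* q :* (con 1 :+ (u :+ w :+ u :* w :* con 2) :* con 2))
               refl (2 ^ e) (2 ^ f) u w ⟩
  2 ^ e * 2 ^ f * (1 + (u + w + u * w * 2) * 2)
    ≡⟨ cong (_* (1 + (u + w + u * w * 2) * 2)) (^-distribˡ-+-* 2 e f) ⟨
  2 ^ (e + f) * (1 + (u + w + u * w * 2) * 2) ∎)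
  where open ≡-Reasoning

2^m∥2^m : ∀ m → 2^ m ∥ 2 ^ m
2^m∥2^m m = exactly 0 (sym (*-identityʳ (2 ^ m)))

2^0∥odd : ∀ u → 2^ 0 ∥ 1 + u * 2
2^0∥odd u = exactly u (sym (*-identityˡ (1 + u * 2)))

oddDoubleFactorial : ℕ → ℕ
oddDoubleFactorial zero    = 1
oddDoubleFactorial (suc m) = (1 + m * 2) * oddDoubleFactorial m

2^0∥oddDoubleFactorial : ∀ m → 2^ 0 ∥ oddDoubleFactorial m
2^0∥oddDoubleFactorial zero    = exactly 0 refl
2^0∥oddDoubleFactorial (suc m) = 2^∥-* (2^0∥odd m) (2^0∥oddDoubleFactorial m)

[m*2]!≡2^m*[2m-1]!!*m! : ∀ m → (m * 2) ! ≡ 2 ^ m * (oddDoubleFactorial m * m !)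
[m*2]!≡2^m*[2m-1]!!*m! zero    = refl
[m*2]!≡2^m*[2m-1]!!*m! (suc m) = begin
  (2 + m * 2) * ((1 + m * 2) * (m * 2) !)
    ≡⟨ cong (λ t → (2 + m * 2) * ((1 + m * 2) * t)) ([m*2]!≡2^m*[2m-1]!!*m! m) ⟩
  (2 + m * 2) * ((1 + m * 2) * (2 ^ m * (oddDoubleFactorial m * m !)))
    ≡⟨ solve 4 (λ m p d f → (con 2 :+ m :* con 2) :* ((con 1 :+ m :* con 2) :* (p :* (d :* f)))
                         := con 2 :* p :* ((con 1 :+ m :* con 2) :* d :* ((con 1 :+ m) :* f)))
               refl m (2 ^ m) (oddDoubleFactorial m) (m !) ⟩
  2 ^ suc m * (oddDoubleFactorial (suc m) * suc m !) ∎
  where open ≡-Reasoning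

digitSum : ∀ {base} → Expansion base → ℕ
digitSum ds = sum (map toℕ ds)

legendre : (ds : Expansion 2) →
           ∃[ e ] e + digitSum ds ≡ fromDigits ds × 2^ e ∥ fromDigits ds !
legendre []       = 0 , refl , exactly 0 refl
legendre (d ∷ ds) with legendre ds
... | e , e+s≡m , 2^e∥m! = m + e , exponent , valuation d
  where
  m = fromDigits ds
  s = digitSum ds

  exponent : m + e + (toℕ d + s) ≡ toℕ d + m * 2
  exponent = begin
    m + e + (toℕ d + s) ≡⟨ solve 4 (λ m e t s → m :+ e :+ (t :+ s) := t :+ (m :+ (e :+ s)))
                                  refl m e (toℕ d) s ⟩
    toℕ d + (m + (e + s)) ≡⟨ cong (λ x → toℕ d + (m + x)) e+s≡m ⟩
    toℕ d + (m + m)       ≡⟨ cong (toℕ d +_) (solve 1 (λ m → m :+ m := m :* con 2) refl m) ⟩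
    toℕ d + m * 2         ∎
    where open ≡-Reasoning

  2^[m+e]∥[m*2]! : 2^ m + e ∥ (m * 2) !
  2^[m+e]∥[m*2]! = subst (2^ m + e ∥_) (sym ([m*2]!≡2^m*[2m-1]!!*m! m))
    (2^∥-* (2^m∥2^m m) (2^∥-* (2^0∥oddDoubleFactorial m) 2^e∥m!))

  valuation : (d : Bit) → 2^ m + e ∥ (toℕ d + m * 2) !
  valuation zero       = 2^[m+e]∥[m*2]!
  valuation (suc zero) = 2^∥-* (2^0∥odd m) 2^[m+e]∥[m*2]!

expansion-digitSum≤ : ∀ L n → n < 2 ^ L → ∃[ ds ] fromDigits {2} ds ≡ n × digitSum ds ≤ L
expansion-digitSum≤ zero    zero    _         = [] , refl , z≤n
expansion-digitSum≤ zero    (suc n) (s≤s ())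
expansion-digitSum≤ (suc L) n       n<2^[1+L] with n divMod 2
... | result q r refl with expansion-digitSum≤ L q q<2^L
  where
  q<2^L : q < 2 ^ L
  q<2^L = *-cancelˡ-< 2 q (2 ^ L) (begin-strict
    2 * q          ≡⟨ *-comm 2 q ⟩
    q * 2          ≤⟨ m≤n+m (q * 2) (toℕ r) ⟩
    toℕ r + q * 2  <⟨ n<2^[1+L] ⟩
    2 * 2 ^ L      ∎)
    where open ≤-Reasoning
...   | ds , refl , s≤L = r ∷ ds , refl , +-mono-≤ (toℕ≤pred[n] r) s≤L

digitSum≡0⇒fromDigits≡0 : (ds : Expansion 2) → digitSum ds ≡ 0 → fromDigits ds ≡ 0
digitSum≡0⇒fromDigits≡0 []              _   = refl
digitSum≡0⇒fromDigits≡0 (zero ∷ ds)     s≡0 = cong (_* 2) (digitSum≡0⇒fromDigits≡0 ds s≡0)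
digitSum≡0⇒fromDigits≡0 (suc zero ∷ ds) ()

n≤2^⌈log2⌉n : ∀ n (rec : Acc _<_ n) → n ≤ 2 ^ ⌈log2⌉ n rec
n≤2^⌈log2⌉n zero                _        = z≤n
n≤2^⌈log2⌉n (suc zero)          _        = s≤s z≤n
n≤2^⌈log2⌉n (suc (suc n))       (acc rs) = begin
  2 + n                   ≤⟨ +-monoʳ-≤ 2 n≤⌈n/2⌉+⌈n/2⌉ ⟩
  2 + (⌈ n /2⌉ + ⌈ n /2⌉) ≡⟨ solve 1 (λ h → con 2 :+ (h :+ h) := con 2 :* (con 1 :+ h)) refl ⌈ n /2⌉ ⟩
  2 * suc ⌈ n /2⌉         ≤⟨ *-monoʳ-≤ 2 (n≤2^⌈log2⌉n (suc ⌈ n /2⌉) (rs (⌈n/2⌉<n n))) ⟩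
  2 * 2 ^ ⌈log2⌉ (suc ⌈ n /2⌉) (rs (⌈n/2⌉<n n)) ∎
  where
  open ≤-Reasoning
  n≤⌈n/2⌉+⌈n/2⌉ : n ≤ ⌈ n /2⌉ + ⌈ n /2⌉
  n≤⌈n/2⌉+⌈n/2⌉ = begin
    n                   ≡⟨ ⌊n/2⌋+⌈n/2⌉≡n n ⟨
    ⌊ n /2⌋ + ⌈ n /2⌉   ≤⟨ +-monoˡ-≤ ⌈ n /2⌉ (⌊n/2⌋≤⌈n/2⌉ n) ⟩
    ⌈ n /2⌉ + ⌈ n /2⌉   ∎

n≤2^⌈log₂n⌉ : ∀ n → n ≤ 2 ^ ⌈log₂ n ⌉
n≤2^⌈log₂n⌉ n = n≤2^⌈log2⌉n n (<-wellFounded n)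

digitSum-balance : ∀ {a b k} (da db dc : Expansion 2) →
                   fromDigits da ≡ a → fromDigits db ≡ b → fromDigits dc ≡ b + k →
                   a ! * b ! ≡ (b + k) ! → a + digitSum dc ≡ k + (digitSum da + digitSum db)
digitSum-balance {a} {b} {k} da db dc refl refl dc≡b+k a!b!≡[b+k]!
  with legendre da | legendre db | legendre dc
... | ea , ea+sa≡a , 2^ea∥a! | eb , eb+sb≡b , 2^eb∥b! | ec , ec+sc≡c , 2^ec∥c! =
  +-cancelˡ-≡ b (a + sc) (k + (sa + sb)) (begin
    b + (a + sc)             ≡⟨ cong₂ (λ x y → x + (y + sc)) eb+sb≡b ea+sa≡a ⟨
    eb + sb + (ea + sa + sc) ≡⟨ solve 5 (λ ea eb sa sb sc → eb :+ sb :+ (ea :+ sa :+ sc)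
                                                          := ea :+ eb :+ sc :+ (sa :+ sb))
                                        refl ea eb sa sb sc ⟩
    ea + eb + sc + (sa + sb) ≡⟨ cong (λ x → x + sc + (sa + sb)) ec≡ea+eb ⟨
    ec + sc + (sa + sb)      ≡⟨ cong (_+ (sa + sb)) (trans ec+sc≡c dc≡b+k) ⟩
    b + k + (sa + sb)        ≡⟨ +-assoc b k (sa + sb) ⟩
    b + (k + (sa + sb))      ∎)
  where
  open ≡-Reasoning
  sa = digitSum da
  sb = digitSum db
  sc = digitSum dc

  ec≡ea+eb : ec ≡ ea + eb
  ec≡ea+eb = 2^∥-unique (subst (2^ ec ∥_) (trans (cong _! dc≡b+k) (sym a!b!≡[b+k]!)) 2^ec∥c!)
                        (2^∥-* 2^ea∥a! 2^eb∥b!)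

a!b!≡[b+k]!⇒k<a : ∀ {a b k} → 0 < a → 0 < b → a ! * b ! ≡ (b + k) ! → k < a
a!b!≡[b+k]!⇒k<a {a} {b} {k} 0<a 0<b a!b!≡[b+k]! = ≰⇒> λ a≤k →
  <-irrefl a!≡rising (≤-<-trans (!-mono-≤ a≤k) (!<rising 0<b (<-≤-trans 0<a a≤k)))
  where
  a!≡rising : a ! ≡ rising b k
  a!≡rising = *-cancelʳ-≡ (a !) (rising b k) (b !) {{b !≢0}} (begin
    a ! * b !         ≡⟨ a!b!≡[b+k]! ⟩
    (b + k) !         ≡⟨ [b+k]!≡b!*rising b k ⟩
    b ! * rising b k  ≡⟨ *-comm (b !) (rising b k) ⟩
    rising b k * b !  ∎)
    where open ≡-Reasoning

a!b!≡[b+k]!⇒a<k+2L : ∀ {a b k L} → 0 < a → a < b → b + k ≤ 2 ^ L →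
                     a ! * b ! ≡ (b + k) ! → a < k + 2 * L
a!b!≡[b+k]!⇒a<k+2L {a} {b} {zero} {L} 0<a a<b b+0≤2^L a!b!≡[b+0]!
  with expansion-digitSum≤ L a (<-≤-trans a<b (≤-trans (m≤m+n b 0) b+0≤2^L)) | toDigits 2 b
... | da , da≡a , sa≤L | db , db≡b = begin-strict
  a           <⟨ m<m+n a 0<a ⟩
  a + a       ≤⟨ +-mono-≤ a≤L (≤-trans a≤L (m≤m+n L 0)) ⟩
  L + (L + 0) ∎
  where
  open ≤-Reasoning
  -- Here c = b may be 2^L, so s₂(b) is not bounded by L; instead it cancels against s₂(c).
  a≡sa : a ≡ digitSum da
  a≡sa = +-cancelʳ-≡ (digitSum db) a (digitSum da)
    (digitSum-balance da db db da≡a db≡b (trans db≡b (sym (+-identityʳ b))) a!b!≡[b+0]!)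
  a≤L : a ≤ L
  a≤L = subst (_≤ L) (sym a≡sa) sa≤L
a!b!≡[b+k]!⇒a<k+2L {a} {b} {suc k} {L} 0<a a<b b+k≤2^L a!b!≡[b+k]!
  with expansion-digitSum≤ L a (<-trans a<b b<2^L) | expansion-digitSum≤ L b b<2^L
     | toDigits 2 (b + suc k)
  where
  b<2^L : b < 2 ^ L
  b<2^L = <-≤-trans (m<m+n b z<s) b+k≤2^L
... | da , da≡a , sa≤L | db , db≡b , sb≤L | dc , dc≡b+k = begin-strict
  a                                   <⟨ m<m+n a 0<sc ⟩
  a + digitSum dc                     ≡⟨ digitSum-balance da db dc da≡a db≡b dc≡b+k a!b!≡[b+k]! ⟩
  suc k + (digitSum da + digitSum db) ≤⟨ +-monoʳ-≤ (suc k) (+-mono-≤ sa≤L (≤-trans sb≤L (m≤m+n L 0))) ⟩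
  suc k + 2 * L                       ∎
  where
  open ≤-Reasoning
  0<sc : 0 < digitSum dc
  0<sc = n≢0⇒n>0 λ sc≡0 → m+1+n≢0 b (trans (sym dc≡b+k) (digitSum≡0⇒fromDigits≡0 dc sc≡0))

proposition1p2 : (a b c : ℕ) → 0 < a → 0 < b → 0 < c → a < b →
    (a !) * (b !) ≡ c ! →
    (c ∸ b) < a × a < (c ∸ b) + 2 * ⌈log₂ c ⌉
proposition1p2 a b c 0<a 0<b 0<c a<b a!b!≡c! =
  a!b!≡[b+k]!⇒k<a 0<a 0<b a!b!≡[b+k]! ,
  a!b!≡[b+k]!⇒a<k+2L {L = ⌈log₂ c ⌉} 0<a a<b (subst (_≤ 2 ^ ⌈log₂ c ⌉) c≡b+k (n≤2^⌈log₂n⌉ c)) a!b!≡[b+k]!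
  where
  k = c ∸ b

  b≤c : b ≤ c
  b≤c = !-cancel-≤ 0<c (≤-trans (m≤n*m (b !) (a !) {{a !≢0}}) (≤-reflexive a!b!≡c!))

  c≡b+k : c ≡ b + k
  c≡b+k = sym (m+[n∸m]≡n b≤c)

  a!b!≡[b+k]! : a ! * b ! ≡ (b + k) !
  a!b!≡[b+k]! = trans a!b!≡c! (cong _! c≡b+k)
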